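{- (1) Let $k$ be a positive integer and $h(z)=\lfloor z/(2k)\rfloor$ for $z\in\mathbb{Z}_{\ge0}$. Then $h$ has the NS-property. (2) Let $h(0)=0$ and $h(z)=2^{\lfloor \log_2 z\rfloor}-1$ for positive integers $z$. Then $h$ has the NS-property.
   Context: A function $h:\mathbb{Z}_{\ge0}\to\mathbb{Z}_{\ge0}$ is monotonically increasing if $h(u)\le h(v)$ whenever $u\le v$. A monotonically increasing function $h$ has the NS-property if both of the following hold: - $h(0)=0$; - for all $z,z'\in\mathbb{Z}_{\ge0}$ and every positive integer $i$, $\lfloor z/2^i\rfloor=\lfloor z'/2^i\rfloor$ implies $\lfloor h(z)/2^{i-1}\rfloor=\lfloor h(z')/2^{i-1}\rfloor$. -}

module Defs where

open import Data.Nat using (ℕ; zero; suc; _*_; _∸_; _^_; _≤_; NonZero)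
open import Data.Nat.DivMod using (_/_)
open import Data.Nat.Logarithm using (⌊log₂_⌋)
open import Data.Nat.Properties using (m^n≢0; m*n≢0)
open import Data.Product using (_×_)
open import Relation.Binary.PropositionalEquality using (_≡_)

_/2^_ : ℕ → ℕ → ℕ
z /2^ i = _/_ z (2 ^ i) {{m^n≢0 2 i}}

Monotone : (ℕ → ℕ) → Set
Monotone h = ∀ u v → u ≤ v → h u ≤ h v

-- the NS-property (for a monotonically increasing h); i ranges over
-- positive integers, written here as suc i
NSProperty : (ℕ → ℕ) → Set
NSProperty h =
  Monotone h ×
  (h 0 ≡ 0) ×
  (∀ z z′ (i : ℕ) → z /2^ suc i ≡ z′ /2^ suc i →
     h z /2^ i ≡ h z′ /2^ i)

hDiv : (k : ℕ) → .{{NonZero k}} → ℕ → ℕ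
hDiv k z = _/_ z (2 * k) {{m*n≢0 2 k}}

hLog : ℕ → ℕ
hLog zero = 0
hLog (suc n) = 2 ^ ⌊log₂ (suc n) ⌋ ∸ 1

-- Both functions commute with halving, h ⌊w/2⌋ = ⌊h w / 2⌋, and h w depends on w only
-- through ⌊w/2⌋. Iterating the first fact gives ⌊h z / 2^i⌋ = h ⌊z / 2^i⌋, which by the
-- second fact depends on z only through ⌊⌊z / 2^i⌋ / 2⌋ = ⌊z / 2^(i+1)⌋.
module Submission where

open import Defs
open import Data.Nat using (ℕ; NonZero; zero; suc; _+_; _*_; _∸_; _^_; _≤_; z≤n; s≤s; ⌊_/2⌋)
open import Data.Nat.Properties
open import Data.Nat.DivMod
open import Data.Nat.Logarithm
open import Data.Product using (_×_; _,_)
open import Relation.Binary.PropositionalEquality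
open ≡-Reasoning

m/n/o≡m/o/n : ∀ m n o .{{_ : NonZero n}} .{{_ : NonZero o}} → m / n / o ≡ m / o / n
m/n/o≡m/o/n m n o = begin
  m / n / o                     ≡⟨ m/n/o≡m/[n*o] m n o {{_}} {{_}} {{m*n≢0 n o}} ⟩
  _/_ m (n * o) {{m*n≢0 n o}}   ≡⟨ /-congʳ {{m*n≢0 n o}} {{m*n≢0 o n}} (*-comm n o) ⟩
  _/_ m (o * n) {{m*n≢0 o n}}   ≡⟨ m/n/o≡m/[n*o] m o n {{_}} {{_}} {{m*n≢0 o n}} ⟨
  m / o / n                     ∎

⌊n/2⌋≡n/2 : ∀ n → ⌊ n /2⌋ ≡ n / 2
⌊n/2⌋≡n/2 zero          = refl
⌊n/2⌋≡n/2 (suc zero)    = refl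
⌊n/2⌋≡n/2 (suc (suc n)) = begin
  suc ⌊ n /2⌋      ≡⟨ cong suc (⌊n/2⌋≡n/2 n) ⟩
  suc (n / 2)      ≡⟨ m/n≡1+[m∸n]/n {suc (suc n)} {2} (s≤s (s≤s z≤n)) ⟨
  suc (suc n) / 2  ∎

⌊[1+2*n]/2⌋≡n : ∀ n → ⌊ suc (2 * n) /2⌋ ≡ n
⌊[1+2*n]/2⌋≡n zero    = refl
⌊[1+2*n]/2⌋≡n (suc n) = cong suc (trans (cong ⌊_/2⌋ (+-suc n (n + 0))) (⌊[1+2*n]/2⌋≡n n))

2*m∸1≡1+2*[m∸1] : ∀ m .{{_ : NonZero m}} → 2 * m ∸ 1 ≡ suc (2 * (m ∸ 1))
2*m∸1≡1+2*[m∸1] (suc m) = +-suc m (m + 0)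

/2^-suc : ∀ z i → z /2^ suc i ≡ z /2^ i / 2
/2^-suc z i = begin
  z /2^ suc i                          ≡⟨ /-congʳ {{m^n≢0 2 (suc i)}} {{2^i*2≢0}} (*-comm 2 (2 ^ i)) ⟩
  _/_ z (2 ^ i * 2) {{2^i*2≢0}}        ≡⟨ m/n/o≡m/[n*o] z (2 ^ i) 2 {{m^n≢0 2 i}} {{_}} {{2^i*2≢0}} ⟨
  z /2^ i / 2                          ∎
  where 2^i*2≢0 = m*n≢0 (2 ^ i) 2 {{m^n≢0 2 i}}

/2^-commute : ∀ (h : ℕ → ℕ) → (∀ w → h w / 2 ≡ h (w / 2)) → ∀ z i → h z /2^ i ≡ h (z /2^ i)
/2^-commute h h/2 z zero    = trans (n/1≡n (h z)) (cong h (sym (n/1≡n z)))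
/2^-commute h h/2 z (suc i) = begin
  h z /2^ suc i    ≡⟨ /2^-suc (h z) i ⟩
  h z /2^ i / 2    ≡⟨ cong (_/ 2) (/2^-commute h h/2 z i) ⟩
  h (z /2^ i) / 2  ≡⟨ h/2 (z /2^ i) ⟩
  h (z /2^ i / 2)  ≡⟨ cong h (/2^-suc z i) ⟨
  h (z /2^ suc i)  ∎

nsProperty : ∀ {h : ℕ → ℕ} → Monotone h → h 0 ≡ 0 →
             (∀ w → h w / 2 ≡ h (w / 2)) →
             (∀ w w′ → w / 2 ≡ w′ / 2 → h w ≡ h w′) →
             NSProperty h
nsProperty {h} mono h0≡0 h/2 h-cong = mono , h0≡0 , λ z z′ i eq → begin
  h z /2^ i     ≡⟨ /2^-commute h h/2 z i ⟩
  h (z /2^ i)   ≡⟨ h-cong _ _ (trans (sym (/2^-suc z i)) (trans eq (/2^-suc z′ i))) ⟩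
  h (z′ /2^ i)  ≡⟨ /2^-commute h h/2 z′ i ⟨
  h z′ /2^ i    ∎

module _ (k : ℕ) .{{_ : NonZero k}} where

  private instance
    2k≢0 : NonZero (2 * k)
    2k≢0 = m*n≢0 2 k

  hDiv-monotone : Monotone (hDiv k)
  hDiv-monotone _ _ = /-monoˡ-≤ (2 * k)

  hDiv-0 : hDiv k 0 ≡ 0
  hDiv-0 = 0/n≡0 (2 * k)

  hDiv-/2 : ∀ w → hDiv k w / 2 ≡ hDiv k (w / 2)
  hDiv-/2 w = m/n/o≡m/o/n w (2 * k) 2

  hDiv≡/2/k : ∀ w → hDiv k w ≡ w / 2 / k
  hDiv≡/2/k w = sym (m/n/o≡m/[n*o] w 2 k)

  hDiv-cong : ∀ w w′ → w / 2 ≡ w′ / 2 → hDiv k w ≡ hDiv k w′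
  hDiv-cong w w′ eq = trans (hDiv≡/2/k w) (trans (cong (_/ k) eq) (sym (hDiv≡/2/k w′)))

hLog-monotone : Monotone hLog
hLog-monotone zero    _       _   = z≤n
hLog-monotone (suc u) (suc v) u≤v = ∸-monoˡ-≤ 1 (^-monoʳ-≤ 2 (⌊log₂⌋-mono-≤ u≤v))

⌊log₂n⌋≡1+⌊log₂⌊n/2⌋⌋ : ∀ n → 2 ≤ n → ⌊log₂ n ⌋ ≡ suc ⌊log₂ ⌊ n /2⌋ ⌋
⌊log₂n⌋≡1+⌊log₂⌊n/2⌋⌋ n 2≤n = begin
  ⌊log₂ n ⌋              ≡⟨ m+[n∸m]≡n (⌊log₂⌋-mono-≤ 2≤n) ⟨
  suc (⌊log₂ n ⌋ ∸ 1)    ≡⟨ cong suc (⌊log₂⌊n/2⌋⌋≡⌊log₂n⌋∸1 n) ⟨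
  suc ⌊log₂ ⌊ n /2⌋ ⌋    ∎

hLog[2+n]≡1+2*hLog⌊[2+n]/2⌋ : ∀ n → hLog (2 + n) ≡ suc (2 * hLog ⌊ 2 + n /2⌋)
hLog[2+n]≡1+2*hLog⌊[2+n]/2⌋ n = begin
  2 ^ ⌊log₂ (2 + n) ⌋ ∸ 1      ≡⟨ cong (λ e → 2 ^ e ∸ 1) (⌊log₂n⌋≡1+⌊log₂⌊n/2⌋⌋ (2 + n) (s≤s (s≤s z≤n))) ⟩
  2 * 2 ^ ℓ ∸ 1                ≡⟨ 2*m∸1≡1+2*[m∸1] (2 ^ ℓ) {{m^n≢0 2 ℓ}} ⟩
  suc (2 * (2 ^ ℓ ∸ 1))        ∎
  where ℓ = ⌊log₂ ⌊ 2 + n /2⌋ ⌋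

hLog-⌊/2⌋ : ∀ w → ⌊ hLog w /2⌋ ≡ hLog ⌊ w /2⌋
hLog-⌊/2⌋ zero          = refl
hLog-⌊/2⌋ (suc zero)    = refl
hLog-⌊/2⌋ (suc (suc n)) = begin
  ⌊ hLog (2 + n) /2⌋                     ≡⟨ cong ⌊_/2⌋ (hLog[2+n]≡1+2*hLog⌊[2+n]/2⌋ n) ⟩
  ⌊ suc (2 * hLog ⌊ 2 + n /2⌋) /2⌋       ≡⟨ ⌊[1+2*n]/2⌋≡n (hLog ⌊ 2 + n /2⌋) ⟩
  hLog ⌊ 2 + n /2⌋                       ∎

hLog-/2 : ∀ w → hLog w / 2 ≡ hLog (w / 2)
hLog-/2 w = begin
  hLog w / 2        ≡⟨ ⌊n/2⌋≡n/2 (hLog w) ⟨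
  ⌊ hLog w /2⌋      ≡⟨ hLog-⌊/2⌋ w ⟩
  hLog ⌊ w /2⌋      ≡⟨ cong hLog (⌊n/2⌋≡n/2 w) ⟩
  hLog (w / 2)      ∎

hLog-cong-⌊/2⌋ : ∀ w w′ → ⌊ w /2⌋ ≡ ⌊ w′ /2⌋ → hLog w ≡ hLog w′
hLog-cong-⌊/2⌋ zero          zero           _  = refl
hLog-cong-⌊/2⌋ zero          (suc zero)     _  = refl
hLog-cong-⌊/2⌋ (suc zero)    zero           _  = refl
hLog-cong-⌊/2⌋ (suc zero)    (suc zero)     _  = refl
hLog-cong-⌊/2⌋ (suc (suc m)) (suc (suc n))  eq = begin
  hLog (2 + m)                     ≡⟨ hLog[2+n]≡1+2*hLog⌊[2+n]/2⌋ m ⟩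
  suc (2 * hLog ⌊ 2 + m /2⌋)       ≡⟨ cong (λ c → suc (2 * hLog c)) eq ⟩
  suc (2 * hLog ⌊ 2 + n /2⌋)       ≡⟨ hLog[2+n]≡1+2*hLog⌊[2+n]/2⌋ n ⟨
  hLog (2 + n)                     ∎

hLog-cong : ∀ w w′ → w / 2 ≡ w′ / 2 → hLog w ≡ hLog w′
hLog-cong w w′ eq = hLog-cong-⌊/2⌋ w w′ (trans (⌊n/2⌋≡n/2 w) (trans eq (sym (⌊n/2⌋≡n/2 w′))))

proposition1 : ((k : ℕ) → .{{_ : NonZero k}} → NSProperty (hDiv k)) × NSProperty hLog
proposition1 =
  (λ k → nsProperty (hDiv-monotone k) (hDiv-0 k) (hDiv-/2 k) (hDiv-cong k)) ,
  nsProperty hLog-monotone refl hLog-/2 hLog-cong
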